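{- Let $m,k$ be integers with $2\le k<m$ and $\frac{m}{k-1}\ge 2$, and let $n$ be a positive integer with $n\le 2^{\lfloor m/(k-1)\rfloor-1}-1$. Then $g(n,m)\ge kn$.
   Context: Write $[m]=\{1,\ldots,m\}$. For a multiset $\mathcal{F}=\{C_1,\ldots,C_t\}$ of non-empty subsets of $[m]$ (repetitions allowed; members indexed by $[t]$), a resolution into $n$ classes is a partition $\{A_1,\ldots,A_n\}$ of $[t]$ into $n$ blocks such that for each $i$ the sets $C_j$, $j\in A_i$, are pairwise disjoint with union $[m]$. $\mathcal{F}$ is uniquely resolvable with respect to $(n,m)$ if it has exactly one resolution into $n$ classes (partitions regarded as unordered). $g(n,m)$ is the maximum size of a uniquely resolvable multiset with respect to $(n,m)$. -}

module Defs where

open import Data.Nat using (ℕ; zero; suc; _/_)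
open import Data.Fin using (Fin)
open import Data.Fin.Subset using (Subset; _∈_; Nonempty)
open import Data.Product using (Σ; ∃; _×_)
open import Relation.Binary.PropositionalEquality using (_≡_; _≢_)
open import Data.Empty using (⊥)
open import Function.Definitions using (Surjective)

-- A multiset F = {C_1,...,C_t} of non-empty subsets of [m], indexed by [t].
Family : ℕ → ℕ → Set
Family m t = Fin t → Subset m

AllNonempty : ∀ {m t} → Family m t → Set
AllNonempty {t = t} C = ∀ (j : Fin t) → Nonempty (C j)

Disjoint : ∀ {m} → Subset m → Subset m → Set
Disjoint {m} A B = ∀ (x : Fin m) → x ∈ A → x ∈ B → ⊥

-- A resolution into n classes, presented by a labelling f : [t] → [n]
-- whose fibres A_i = f⁻¹(i) are the blocks.  The labelling is surjective
-- (blocks of a partition are non-empty) and every block consists of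
-- pairwise disjoint sets whose union is [m].
IsResolution : ∀ {m t} (n : ℕ) → Family m t → (Fin t → Fin n) → Set
IsResolution {m} {t} n C f =
  Surjective _≡_ _≡_ f ×
  (∀ (i : Fin n) (j j′ : Fin t) → j ≢ j′ → f j ≡ i → f j′ ≡ i →
     Disjoint (C j) (C j′)) ×
  (∀ (i : Fin n) (x : Fin m) → ∃ λ (j : Fin t) → f j ≡ i × x ∈ C j)

-- Two labellings induce the same (unordered) partition of [t].
SamePartition : ∀ {t n} → (Fin t → Fin n) → (Fin t → Fin n) → Set
SamePartition {t} f g =
  ∀ (j j′ : Fin t) → (f j ≡ f j′ → g j ≡ g j′) × (g j ≡ g j′ → f j ≡ f j′)

UniquelyResolvable : ∀ {m t} (n : ℕ) → Family m t → Set
UniquelyResolvable {m} {t} n C =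
  AllNonempty C ×
  (Σ (Fin t → Fin n) λ f → IsResolution n C f ×
     (∀ (g : Fin t → Fin n) → IsResolution n C g → SamePartition f g))

-- "g(n,m) ≥ N": some uniquely resolvable multiset w.r.t. (n,m) has size ≥ N.
-- (g is the maximum of such sizes.)
open import Data.Nat using (_≤_)
gAtLeast : ℕ → ℕ → ℕ → Set
gAtLeast n m N = Σ ℕ λ t → N ≤ t × Σ (Family m t) λ C → UniquelyResolvable n C

-- Floor division ⌊a / d⌋ (with the irrelevant convention ⌊a/0⌋ = 0).
floorDiv : ℕ → ℕ → ℕ
floorDiv a zero = zero
floorDiv a (suc d) = a / suc d

{-# OPTIONS --safe #-}
module Submission where

-- Cut [m] into k − 1 chunks of q = ⌊m/(k−1)⌋ points (leftover points behave like
-- anchors of chunk 0).  In each chunk one point is an anchor and the other q − 1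
-- points carry the binary digits of a code 1 ≤ c(a) < 2^(q−1) of each class a.
-- Point x of chunk j lies in layer j of class a if its digit for a is 0 and in
-- layer j + 1 if it is 1; the k layers of the n classes are the n·k sets.  In any
-- resolution, anchors and a pigeonhole argument give every resolution class exactly
-- one set of each layer; disjointness then forces the sets of layers j and j + 1 in
-- a resolution class to carry the same digits on chunk j, hence the same code, so
-- every resolution class is one of the intended classes.

open import Defs
open import Data.Nat using (ℕ; _≤_; _<_; _*_; _∸_; _^_)
open import Data.Nat using (zero; suc; _+_; _/_; _%_; s≤s)
open import Data.Nat.Properties
  using (*-comm; *-zeroʳ; ≤-reflexive; ≤-<-trans; suc-injective; 1+n≰n;
         m^n≢0; m≤pred[n]⇒suc[m]≤n)
open import Data.Nat.DivMod using (m≡m%n+[m/n]*n)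
open import Data.Fin
  using (Fin; zero; suc; toℕ; fromℕ<; inject₁; combine; remQuot; splitAt; _↑ʳ_;
         finToFun; funToFin; punchOut)
open import Data.Fin.Properties
  using (_≟_; any?; toℕ<n; toℕ-fromℕ<; toℕ-injective; toℕ-combine; remQuot-combine;
         combine-remQuot; splitAt-↑ʳ; funToFin-finToFin; injective⇒≤; punchOut-injective;
         ¬∀⟶∃¬)
open import Data.Fin.Induction using (<-weakInduction)
open import Data.Fin.Subset using (_∈_; Nonempty)
open import Data.Vec using (tabulate)
open import Data.Vec.Properties using (lookup∘tabulate; []=⇒lookup; lookup⇒[]=)
open import Data.Product using (∃; _×_; _,_; proj₁; proj₂)
open import Data.Sum as Sum using (_⊎_; inj₂; [_,_]′)
open import Data.Empty using (⊥; ⊥-elim)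
open import Function using (_∘_)
open import Function.Definitions using (Injective; Surjective; StrictlySurjective)
open import Relation.Binary.PropositionalEquality
open import Relation.Nullary using (yes; no; does; contradiction)
open import Relation.Nullary.Decidable using (dec-true)
open import Relation.Unary using (Decidable)

injective⇒surjective : ∀ {n} {f : Fin n → Fin n} →
  Injective _≡_ _≡_ f → StrictlySurjective _≡_ f
injective⇒surjective {suc n} {f} f-inj y with any? (λ x → f x ≟ y)
... | yes found = found
... | no missed = contradiction (injective⇒≤ f-avoiding-y-injective) 1+n≰n
  where
  f-avoiding-y : Fin (suc n) → Fin n
  f-avoiding-y x = punchOut {i = y} {j = f x} (λ y≡fx → missed (x , sym y≡fx))

  f-avoiding-y-injective : Injective _≡_ _≡_ f-avoiding-y
  f-avoiding-y-injective eq = f-inj (punchOut-injective {i = y} _ _ eq)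

funToFin-cong : ∀ {m n} {f g : Fin m → Fin n} → f ≗ g → funToFin f ≡ funToFin g
funToFin-cong {zero}  f≗g = refl
funToFin-cong {suc m} f≗g = cong₂ combine (f≗g zero) (funToFin-cong (f≗g ∘ suc))

finToFun-injective : ∀ {b w} {c c′ : Fin (b ^ w)} →
  finToFun {b} {w} c ≗ finToFun c′ → c ≡ c′
finToFun-injective {b} {w} {c} {c′} eq = begin
  c                              ≡⟨ funToFin-finToFin {w} {b} c ⟨
  funToFin {w} {b} (finToFun c)  ≡⟨ funToFin-cong {w} {b} eq ⟩
  funToFin {w} {b} (finToFun c′) ≡⟨ funToFin-finToFin {w} {b} c′ ⟩
  c′                             ∎
  where open ≡-Reasoning

toℕ-funToFin-zero : ∀ {w b} → toℕ (funToFin {w} {suc b} (λ _ → zero)) ≡ 0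
toℕ-funToFin-zero {zero}      = refl
toℕ-funToFin-zero {suc w} {b} = begin
  toℕ (combine {suc b} {suc b ^ w} zero (funToFin {w} (λ _ → zero)))
    ≡⟨ toℕ-combine {suc b} {suc b ^ w} zero (funToFin {w} (λ _ → zero)) ⟩
  suc b ^ w * 0 + toℕ (funToFin {w} {suc b} (λ _ → zero))
    ≡⟨ cong₂ _+_ (*-zeroʳ (suc b ^ w)) (toℕ-funToFin-zero {w} {b}) ⟩
  0 ∎
  where open ≡-Reasoning

finToFun≗0⇒toℕ≡0 : ∀ {b w} {c : Fin (suc b ^ w)} →
  finToFun {suc b} {w} c ≗ (λ _ → zero) → toℕ c ≡ 0
finToFun≗0⇒toℕ≡0 {b} {w} {c} all-zero = begin
  toℕ c                                   ≡⟨ cong toℕ (funToFin-finToFin {w} {suc b} c) ⟨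
  toℕ (funToFin {w} {suc b} (finToFun c)) ≡⟨ cong toℕ (funToFin-cong {w} {suc b} all-zero) ⟩
  toℕ (funToFin {w} {suc b} (λ _ → zero)) ≡⟨ toℕ-funToFin-zero {w} {b} ⟩
  0                                       ∎
  where open ≡-Reasoning

Fin2-≢0⇒≡1 : {d : Fin 2} → d ≢ zero → d ≡ suc zero
Fin2-≢0⇒≡1 {zero}     d≢0 = contradiction refl d≢0
Fin2-≢0⇒≡1 {suc zero} _   = refl

toℕ≢0⇒finToFun≡1 : ∀ {w} (c : Fin (2 ^ w)) → toℕ c ≢ 0 →
  ∃ λ i → finToFun {2} {w} c i ≡ suc zero
toℕ≢0⇒finToFun≡1 {w} c c≢0 =
  let i , dᵢ≢0 = ¬∀⟶∃¬ w _ (λ i → finToFun c i ≟ zero) (c≢0 ∘ finToFun≗0⇒toℕ≡0 {1} {w})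
  in  i , Fin2-≢0⇒≡1 dᵢ≢0

∈-tabulate⁺ : ∀ {m} {P : Fin m → Set} (P? : Decidable P) {x} →
  P x → x ∈ tabulate (does ∘ P?)
∈-tabulate⁺ P? {x} px =
  lookup⇒[]= x _ (trans (lookup∘tabulate (does ∘ P?) x) (dec-true (P? x) px))

∈-tabulate⁻ : ∀ {m} {P : Fin m → Set} (P? : Decidable P) {x} →
  x ∈ tabulate (does ∘ P?) → P x
∈-tabulate⁻ P? {x} x∈ with P? x | trans (sym (lookup∘tabulate (does ∘ P?) x)) ([]=⇒lookup x∈)
... | yes px | _  = px
... | no _   | ()

module Layered {m n K : ℕ}
  (chunk : Fin m → Fin (suc K))
  (digit : Fin n → Fin m → Fin 2)
  (anchor : ∀ j → ∃ λ x → chunk x ≡ j × ∀ a → digit a x ≡ zero)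
  (riser : ∀ a j → ∃ λ x → chunk x ≡ j × digit a x ≡ suc zero)
  (digits-separate : ∀ j {a b} → (∀ x → chunk x ≡ j → digit a x ≡ digit b x) → a ≡ b)
  where

  Layer : Set
  Layer = Fin (suc (suc K))

  raise : Fin 2 → Fin (suc K) → Layer
  raise zero       j = inject₁ j
  raise (suc zero) j = suc j

  layer-of : Fin n → Fin m → Layer
  layer-of a x = raise (digit a x) (chunk x)

  Index : Set
  Index = Fin (n * suc (suc K))

  cls : Index → Fin n
  cls u = proj₁ (remQuot {n} (suc (suc K)) u)

  layer : Index → Layer
  layer u = proj₂ (remQuot {n} (suc (suc K)) u)

  cls-combine : ∀ a ℓ → cls (combine a ℓ) ≡ a
  cls-combine a ℓ = cong proj₁ (remQuot-combine {n} a ℓ)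

  layer-combine : ∀ a ℓ → layer (combine a ℓ) ≡ ℓ
  layer-combine a ℓ = cong proj₂ (remQuot-combine {n} a ℓ)

  index-≡ : ∀ {u v} → cls u ≡ cls v → layer u ≡ layer v → u ≡ v
  index-≡ {u} {v} c≡ ℓ≡ = begin
    u                        ≡⟨ combine-remQuot {n} (suc (suc K)) u ⟨
    combine (cls u) (layer u) ≡⟨ cong₂ combine c≡ ℓ≡ ⟩
    combine (cls v) (layer v) ≡⟨ combine-remQuot {n} (suc (suc K)) v ⟩
    v                        ∎
    where open ≡-Reasoning

  C : Family m (n * suc (suc K))
  C u = tabulate (does ∘ λ x → layer-of (cls u) x ≟ layer u)

  ∈C⁺ : ∀ {u x} → layer-of (cls u) x ≡ layer u → x ∈ C u
  ∈C⁺ {u} = ∈-tabulate⁺ (λ x → layer-of (cls u) x ≟ layer u)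

  ∈C⁻ : ∀ {u x} → x ∈ C u → layer-of (cls u) x ≡ layer u
  ∈C⁻ {u} = ∈-tabulate⁻ (λ x → layer-of (cls u) x ≟ layer u)

  ∈C-raise : ∀ {u x j d} →
    chunk x ≡ j → digit (cls u) x ≡ d → layer u ≡ raise d j → x ∈ C u
  ∈C-raise x∈j dₓ ℓ≡ = ∈C⁺ (trans (cong₂ raise dₓ x∈j) (sym ℓ≡))

  ∈C-layer : ∀ {u x j d} →
    x ∈ C u → chunk x ≡ j → digit (cls u) x ≡ d → layer u ≡ raise d j
  ∈C-layer x∈u x∈j dₓ = trans (sym (∈C⁻ x∈u)) (cong₂ raise dₓ x∈j)

  anchor∈ : ∀ {u} j → layer u ≡ inject₁ j → proj₁ (anchor j) ∈ C u
  anchor∈ {u} j ℓ≡ = let _ , x∈j , dₓ = anchor j in ∈C-raise x∈j (dₓ (cls u)) ℓ≡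

  ∈C-combine : ∀ a x → x ∈ C (combine a (layer-of a x))
  ∈C-combine a x =
    ∈C⁺ (trans (cong (λ b → layer-of b x) (cls-combine a _)) (sym (layer-combine a _)))

  nonempty : AllNonempty C
  nonempty u = nonempty-at (layer u) refl
    where
    nonempty-at : ∀ ℓ → layer u ≡ ℓ → Nonempty (C u)
    nonempty-at zero    ℓ≡ = proj₁ (anchor zero) , anchor∈ zero ℓ≡
    nonempty-at (suc j) ℓ≡ = let x , x∈j , dₓ = riser (cls u) j in x , ∈C-raise x∈j dₓ ℓ≡

  cls-resolution : IsResolution n C cls
  cls-resolution = surjective , disjoint , covering
    where
    surjective : Surjective _≡_ _≡_ cls
    surjective a = combine a zero , λ u≡ → trans (cong cls u≡) (cls-combine a zero)

    disjoint : ∀ i u v → u ≢ v → cls u ≡ i → cls v ≡ i → Disjoint (C u) (C v)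
    disjoint i u v u≢v refl c≡ x x∈u x∈v =
      u≢v (index-≡ (sym c≡)
        (trans (sym (∈C⁻ x∈u)) (trans (cong (λ a → layer-of a x) (sym c≡)) (∈C⁻ x∈v))))

    covering : ∀ i x → ∃ λ u → cls u ≡ i × x ∈ C u
    covering i x = combine i (layer-of i x) , cls-combine i _ , ∈C-combine i x

  module Uniqueness {g : Index → Fin n} (res : IsResolution n C g) where

    cover : ∀ i x → ∃ λ u → g u ≡ i × x ∈ C u
    cover = proj₂ (proj₂ res)

    cover-unique : ∀ {u v x} → g u ≡ g v → x ∈ C u → x ∈ C v → u ≡ v
    cover-unique {u} {v} {x} g≡ x∈u x∈v with u ≟ v
    ... | yes u≡v = u≡v
    ... | no u≢v  = ⊥-elim (proj₁ (proj₂ res) (g u) u v u≢v refl (sym g≡) x x∈u x∈v)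

    anchor-cover : ∀ i j → ∃ λ u → g u ≡ i × layer u ≡ inject₁ j
    anchor-cover i j =
      let x , x∈j , dₓ = anchor j
          u , gu , x∈u = cover i x
      in  u , gu , ∈C-layer x∈u x∈j (dₓ (cls u))

    -- A cover w of a riser of u in layer inject₁ j would share the anchor of chunk j
    -- with u, so w = u, contradicting the digit of the riser.
    riser-cover : ∀ i j → ∃ λ w → g w ≡ i × layer w ≡ suc j
    riser-cover i j with anchor-cover i j
    ... | u , gu , ℓu with riser (cls u) j
    ...   | x , x∈j , dₓ with cover i x
    ...     | w , gw , x∈w with digit (cls w) x in d
    ...       | suc zero = w , gw , ∈C-layer x∈w x∈j d
    ...       | zero     =
      contradiction (trans (sym d) (trans (cong (λ v → digit (cls v) x) w≡u) dₓ)) λ ()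
      where
      w≡u : w ≡ u
      w≡u = cover-unique (trans gw (sym gu)) (anchor∈ j (∈C-layer x∈w x∈j d)) (anchor∈ j ℓu)

    has-layer : ∀ i ℓ → ∃ λ u → g u ≡ i × layer u ≡ ℓ
    has-layer i zero    = anchor-cover i zero
    has-layer i (suc j) = riser-cover i j

    rep : Layer → Fin n → Index
    rep ℓ i = proj₁ (has-layer i ℓ)

    g-rep : ∀ ℓ i → g (rep ℓ i) ≡ i
    g-rep ℓ i = proj₁ (proj₂ (has-layer i ℓ))

    layer-rep : ∀ ℓ i → layer (rep ℓ i) ≡ ℓ
    layer-rep ℓ i = proj₂ (proj₂ (has-layer i ℓ))

    cls-rep-injective : ∀ ℓ → Injective _≡_ _≡_ (cls ∘ rep ℓ)
    cls-rep-injective ℓ {i} {i′} c≡ = begin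
      i            ≡⟨ g-rep ℓ i ⟨
      g (rep ℓ i)  ≡⟨ cong g (index-≡ c≡ (trans (layer-rep ℓ i) (sym (layer-rep ℓ i′)))) ⟩
      g (rep ℓ i′) ≡⟨ g-rep ℓ i′ ⟩
      i′           ∎
      where open ≡-Reasoning

    -- Every resolution class has one member in each layer, and there are as many
    -- classes as members of a layer, so each class has exactly one.
    rep-unique : ∀ u → rep (layer u) (g u) ≡ u
    rep-unique u =
      let i , c≡ = injective⇒surjective (cls-rep-injective (layer u)) (cls u)
          rep≡u = index-≡ c≡ (layer-rep (layer u) i)
      in  trans (cong (rep (layer u)) (trans (sym (cong g rep≡u)) (g-rep (layer u) i))) rep≡u

    rep-digit : ∀ i {x j} → chunk x ≡ j → ∃ λ d → digit (cls (rep (raise d j) i)) x ≡ d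
    rep-digit i {x} {j} x∈j =
      let v , gv , x∈v = cover i x
          rep≡v = subst (λ ℓ → rep ℓ (g v) ≡ v) (∈C-layer x∈v x∈j refl) (rep-unique v)
          d = digit (cls v) x
      in  d , cong (λ w → digit (cls w) x) (trans (cong (rep (raise d j)) (sym gv)) rep≡v)

    module _ (i : Fin n) (j : Fin (suc K)) where
      private
        u w : Index
        u = rep (inject₁ j) i
        w = rep (suc j) i

      not-both : ∀ {x} →
        chunk x ≡ j → digit (cls u) x ≡ zero → digit (cls w) x ≡ suc zero → ⊥
      not-both {x} x∈j du dw =
        contradiction (trans (sym du) (trans (cong (λ v → digit (cls v) x) u≡w) dw)) λ ()
        where
        u≡w : u ≡ w
        u≡w = cover-unique (trans (g-rep (inject₁ j) i) (sym (g-rep (suc j) i)))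
                (∈C-raise x∈j du (layer-rep (inject₁ j) i)) (∈C-raise x∈j dw (layer-rep (suc j) i))

      digits-agree : ∀ x → chunk x ≡ j → digit (cls u) x ≡ digit (cls w) x
      digits-agree x x∈j with rep-digit i x∈j
      ... | zero , du with digit (cls w) x in dw
      ...   | zero     = du
      ...   | suc zero = ⊥-elim (not-both x∈j du dw)
      digits-agree x x∈j | suc zero , dw with digit (cls u) x in du
      ...   | zero     = ⊥-elim (not-both x∈j du dw)
      ...   | suc zero = sym dw

      rep-step : cls u ≡ cls w
      rep-step = digits-separate j digits-agree

    class-label : Fin n → Fin n
    class-label i = cls (rep zero i)

    cls-rep : ∀ i ℓ → cls (rep ℓ i) ≡ class-label i
    cls-rep i = <-weakInduction (λ ℓ → cls (rep ℓ i) ≡ class-label i) refl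
                  (λ j IH → trans (sym (rep-step i j)) IH)

    cls≡class-label∘g : ∀ u → cls u ≡ class-label (g u)
    cls≡class-label∘g u = trans (cong cls (sym (rep-unique u))) (cls-rep (g u) (layer u))

    same-partition : SamePartition cls g
    same-partition u v =
      (λ c≡ → cls-rep-injective zero
                (trans (sym (cls≡class-label∘g u)) (trans c≡ (cls≡class-label∘g v)))) ,
      (λ g≡ → trans (cls≡class-label∘g u)
                (trans (cong class-label g≡) (sym (cls≡class-label∘g v))))

  uniquely-resolvable : UniquelyResolvable n C
  uniquely-resolvable = nonempty , cls , cls-resolution , λ g res → Uniqueness.same-partition res

module BinaryLayout (K w r n : ℕ) (n<2^w : n < 2 ^ w) where

  Point : Set
  Point = Fin (r + suc w * suc K)

  place : Fin (suc w) → Fin (suc K) → Point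
  place p j = r ↑ʳ combine p j

  locate : Point → Fin r ⊎ (Fin (suc w) × Fin (suc K))
  locate x = Sum.map₂ (remQuot (suc K)) (splitAt r x)

  locate-place : ∀ p j → locate (place p j) ≡ inj₂ (p , j)
  locate-place p j rewrite splitAt-↑ʳ r (suc w * suc K) (combine p j) =
    cong inj₂ (remQuot-combine p j)

  -- Codes start at 1, so every code has a binary digit 1.
  code : Fin n → Fin (2 ^ w)
  code a = fromℕ< (≤-<-trans (toℕ<n a) n<2^w)

  toℕ-code : ∀ a → toℕ (code a) ≡ suc (toℕ a)
  toℕ-code a = toℕ-fromℕ< _

  code-injective : Injective _≡_ _≡_ code
  code-injective {a} {b} eq = toℕ-injective (suc-injective (begin
    suc (toℕ a)    ≡⟨ toℕ-code a ⟨
    toℕ (code a)   ≡⟨ cong toℕ eq ⟩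
    toℕ (code b)   ≡⟨ toℕ-code b ⟩
    suc (toℕ b)    ∎))
    where open ≡-Reasoning

  position-digit : Fin n → Fin (suc w) → Fin 2
  position-digit a zero    = zero
  position-digit a (suc i) = finToFun (code a) i

  chunk : Point → Fin (suc K)
  chunk x = [ (λ _ → zero) , proj₂ ]′ (locate x)

  digit : Fin n → Point → Fin 2
  digit a x = [ (λ _ → zero) , position-digit a ∘ proj₁ ]′ (locate x)

  chunk-place : ∀ p j → chunk (place p j) ≡ j
  chunk-place p j = cong [ (λ _ → zero) , proj₂ ]′ (locate-place p j)

  digit-place : ∀ a p j → digit a (place p j) ≡ position-digit a p
  digit-place a p j = cong [ (λ _ → zero) , position-digit a ∘ proj₁ ]′ (locate-place p j)

  anchor : ∀ j → ∃ λ x → chunk x ≡ j × ∀ a → digit a x ≡ zero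
  anchor j = place zero j , chunk-place zero j , λ a → digit-place a zero j

  riser : ∀ a j → ∃ λ x → chunk x ≡ j × digit a x ≡ suc zero
  riser a j =
    let i , dᵢ = toℕ≢0⇒finToFun≡1 (code a) λ code≡0 →
                   contradiction (trans (sym (toℕ-code a)) code≡0) λ ()
    in  place (suc i) j , chunk-place (suc i) j , trans (digit-place a (suc i) j) dᵢ

  digits-separate : ∀ j {a b} → (∀ x → chunk x ≡ j → digit a x ≡ digit b x) → a ≡ b
  digits-separate j {a} {b} agree = code-injective (finToFun-injective {2} {w} λ i → begin
    finToFun (code a) i        ≡⟨ digit-place a (suc i) j ⟨
    digit a (place (suc i) j)  ≡⟨ agree (place (suc i) j) (chunk-place (suc i) j) ⟩
    digit b (place (suc i) j)  ≡⟨ digit-place b (suc i) j ⟩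
    finToFun (code b) i        ∎)
    where open ≡-Reasoning

  open Layered chunk digit anchor riser digits-separate public

gAtLeast-chunked : ∀ K q r n → 1 ≤ n → n ≤ 2 ^ (q ∸ 1) ∸ 1 →
  gAtLeast n (r + q * suc K) (suc (suc K) * n)
gAtLeast-chunked K zero    r (suc n) _ ()
gAtLeast-chunked K (suc w) r n       _ n≤ =
  n * suc (suc K) , ≤-reflexive (*-comm (suc (suc K)) n) , C , uniquely-resolvable
  where open BinaryLayout K w r n (m≤pred[n]⇒suc[m]≤n {{m^n≢0 2 w}} n≤)

lemma22 : ∀ (m k n : ℕ) → 2 ≤ k → k < m → 2 * (k ∸ 1) ≤ m →
    1 ≤ n → n ≤ 2 ^ (floorDiv m (k ∸ 1) ∸ 1) ∸ 1 →
    gAtLeast n m (k * n)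
lemma22 m (suc (suc K)) n (s≤s (s≤s _)) _ _ 1≤n n≤ =
  subst (λ m′ → gAtLeast n m′ (suc (suc K) * n)) (sym (m≡m%n+[m/n]*n m (suc K)))
    (gAtLeast-chunked K (m / suc K) (m % suc K) n 1≤n n≤)
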